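{- Let $A=(B,\hat{B},\iota)$ be an arch where $B$ admits an elimination $\epsilon$. Suppose that $\hat{B}$ satisfies {\bf(sur)}. Then for each $R\subseteq \hat{L}_1$, $(\iota|_{L_{1}},\epsilon)$ is a bitranslation between $(L_1,T_1\cup R)$ and $(L_2,T_2\cup\iota R)$.
   Context: Languages $\mathfrak{L}_1,\mathfrak{L}_2$ are first-order (possibly multi-sorted). An $\mathfrak{L}$-fragment is a set of $\mathfrak{L}$-sentences containing $\top,\perp$ and closed under $\wedge,\vee$; an $\mathfrak{L}$-context is a pair $(L,T)$ with $L$ a fragment and $T$ an $\mathfrak{L}$-theory. A translation from $(L_1,T_1)$ to $(L_2,T_2)$ is a map $\tau:L_1\to L_2$ with $T_1\models\varphi\iff T_2\models\tau\varphi$ for all $\varphi\in L_1$; a bitranslation is a pair $(\tau_1,\tau_2)$ of translations in both directions with $T_1\models\varphi\leftrightarrow\tau_2\tau_1\varphi$ for all $\varphi\in L_1$ and $T_2\models\psi\leftrightarrow\tau_1\tau_2\psi$ for all $\psi\in L_2$. A bridge $B=(C_1,C_2,\sigma)$ consists of contexts $C_i=(L_i,T_i)$ and a class function $\sigma:\mathrm{Mod}(T_2)\to\mathrm{Mod}(T_1)$. An interpretation for $B$ is a map $\iota:L_1\to L_2$ with $\sigma M\models\varphi\iff M\models\iota\varphi$ for all $\varphi\in L_1$, $M\models T_2$; an elimination is a map $\epsilon:L_2\to L_1$ with $\sigma M\models\epsilon\psi\iff M\models\psi$ for all $\psi\in L_2$, $M\models T_2$. $B$ satisfies {\bf(sur)}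 if for every $N\models T_1$ there is $M\models T_2$ with $\mathrm{Th}_{L_1}(N)=\mathrm{Th}_{L_1}(\sigma M)$. An arch is a triple $(B,\hat{B},\iota)$ where $\hat{B}=((\hat{L}_1,T_1),(\hat{L}_2,T_2),\sigma)$ with $L_i\subseteq\hat{L}_i$ (a fragment extension of $B$ with the same theories and $\sigma$), $\iota$ is an interpretation for $\hat{B}$, and $\iota|_{L_1}$ is an interpretation for $B$. -}

module Defs where

open import Level using (Level; 0ℓ) renaming (suc to lsuc)
open import Data.List using (List; []; _∷_)
open import Data.List.Membership.Propositional using (_∈_)
open import Data.List.Relation.Unary.All using (All; lookup; []; _∷_)
open import Data.Product using (Σ; _×_; _,_; proj₁; proj₂)
open import Data.Sum using (_⊎_)
open import Data.Empty.Polymorphic using (⊥)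
open import Data.Unit.Polymorphic using (⊤)
open import Relation.Binary.PropositionalEquality using (_≡_)
open import Relation.Unary using (Pred; _⊆_; _∪_)
open import Function.Bundles using (_⇔_)

record Signature : Set₁ where
  field
    Sort    : Set
    Func    : Set
    funArgs : Func → List Sort
    funSort : Func → Sort
    Rel     : Set
    relArgs : Rel → List Sort

module _ (𝔏 : Signature) where
  open Signature 𝔏

  Ctx : Set
  Ctx = List Sort

  mutual
    data Term (Γ : Ctx) : Sort → Set where
      var : ∀ {s} → s ∈ Γ → Term Γ s
      app : (f : Func) → Terms Γ (funArgs f) → Term Γ (funSort f)

    data Terms (Γ : Ctx) : List Sort → Set where
      []  : Terms Γ []
      _∷_ : ∀ {s ss} → Term Γ s → Terms Γ ss → Terms Γ (s ∷ ss)

  data Formula (Γ : Ctx) : Set where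
    ⊤ᶠ ⊥ᶠ : Formula Γ
    rel   : (r : Rel) → Terms Γ (relArgs r) → Formula Γ
    equal : ∀ {s} → Term Γ s → Term Γ s → Formula Γ
    ¬ᶠ    : Formula Γ → Formula Γ
    _∧ᶠ_ _∨ᶠ_ _⇒ᶠ_ : Formula Γ → Formula Γ → Formula Γ
    ∀ᶠ ∃ᶠ : (s : Sort) → Formula (s ∷ Γ) → Formula Γ

  Sentence : Set
  Sentence = Formula []

  Theory : Set₁
  Theory = Pred Sentence 0ℓ

_⇔ᶠ_ : ∀ {𝔏 Γ} → Formula 𝔏 Γ → Formula 𝔏 Γ → Formula 𝔏 Γ
φ ⇔ᶠ ψ = (φ ⇒ᶠ ψ) ∧ᶠ (ψ ⇒ᶠ φ)

record Structure (𝔏 : Signature) (ℓ : Level) : Set (lsuc ℓ) where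
  open Signature 𝔏
  field
    Dom      : Sort → Set ℓ
    nonempty : (s : Sort) → Dom s
    funI     : (f : Func) → All Dom (funArgs f) → Dom (funSort f)
    relI     : (r : Rel) → All Dom (relArgs r) → Set ℓ

module _ {𝔏 : Signature} {ℓ : Level} (M : Structure 𝔏 ℓ) where
  open Signature 𝔏
  open Structure M

  Env : Ctx 𝔏 → Set ℓ
  Env Γ = All Dom Γ

  mutual
    evalT : ∀ {Γ s} → Term 𝔏 Γ s → Env Γ → Dom s
    evalT (var x)    ρ = lookup ρ x
    evalT (app f ts) ρ = funI f (evalTs ts ρ)

    evalTs : ∀ {Γ ss} → Terms 𝔏 Γ ss → Env Γ → All Dom ss
    evalTs []       ρ = []
    evalTs (t ∷ ts) ρ = evalT t ρ ∷ evalTs ts ρ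

  Sat : ∀ {Γ} → Formula 𝔏 Γ → Env Γ → Set ℓ
  Sat ⊤ᶠ          ρ = ⊤
  Sat ⊥ᶠ          ρ = ⊥
  Sat (rel r ts)  ρ = relI r (evalTs ts ρ)
  Sat (equal t u) ρ = evalT t ρ ≡ evalT u ρ
  Sat (¬ᶠ φ)      ρ = Sat φ ρ → ⊥ {ℓ}
  Sat (φ ∧ᶠ ψ)    ρ = Sat φ ρ × Sat ψ ρ
  Sat (φ ∨ᶠ ψ)    ρ = Sat φ ρ ⊎ Sat ψ ρ
  Sat (φ ⇒ᶠ ψ)    ρ = Sat φ ρ → Sat ψ ρ
  Sat (∀ᶠ s φ)    ρ = (d : Dom s) → Sat φ (d ∷ ρ)
  Sat (∃ᶠ s φ)    ρ = Σ (Dom s) λ d → Sat φ (d ∷ ρ)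

  _⊨_ : Sentence 𝔏 → Set ℓ
  _⊨_ φ = Sat φ []

  _⊨T_ : Theory 𝔏 → Set ℓ
  _⊨T_ T = ∀ φ → T φ → _⊨_ φ

Entails : ∀ {𝔏} (ℓ : Level) → Theory 𝔏 → Sentence 𝔏 → Set (lsuc ℓ)
Entails {𝔏} ℓ T φ = (M : Structure 𝔏 ℓ) → M ⊨T T → M ⊨ φ

record IsFragment {𝔏 : Signature} (L : Pred (Sentence 𝔏) 0ℓ) : Set where
  field
    ⊤∈ : L ⊤ᶠ
    ⊥∈ : L ⊥ᶠ
    ∧∈ : ∀ {φ ψ} → L φ → L ψ → L (φ ∧ᶠ ψ)
    ∨∈ : ∀ {φ ψ} → L φ → L ψ → L (φ ∨ᶠ ψ)

record Context (𝔏 : Signature) : Set₁ where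
  field
    L          : Pred (Sentence 𝔏) 0ℓ
    isFragment : IsFragment L
    T          : Theory 𝔏

Elem : ∀ {𝔏} → Pred (Sentence 𝔏) 0ℓ → Set
Elem {𝔏} L = Σ (Sentence 𝔏) L

withTheory : ∀ {𝔏} → Context 𝔏 → Theory 𝔏 → Context 𝔏
withTheory C T' = record { L = Context.L C ; isFragment = Context.isFragment C ; T = T' }

IsTranslation : ∀ {𝔏₁ 𝔏₂} (ℓ : Level) (C₁ : Context 𝔏₁) (C₂ : Context 𝔏₂) →
                (Elem (Context.L C₁) → Elem (Context.L C₂)) → Set (lsuc ℓ)
IsTranslation ℓ C₁ C₂ τ =
  (φ : Elem (Context.L C₁)) →
    Entails ℓ (Context.T C₁) (proj₁ φ) ⇔ Entails ℓ (Context.T C₂) (proj₁ (τ φ))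

IsBitranslation : ∀ {𝔏₁ 𝔏₂} (ℓ : Level) (C₁ : Context 𝔏₁) (C₂ : Context 𝔏₂) →
                  (Elem (Context.L C₁) → Elem (Context.L C₂)) →
                  (Elem (Context.L C₂) → Elem (Context.L C₁)) → Set (lsuc ℓ)
IsBitranslation ℓ C₁ C₂ τ₁ τ₂ =
  IsTranslation ℓ C₁ C₂ τ₁ ×
  IsTranslation ℓ C₂ C₁ τ₂ ×
  ((φ : Elem (Context.L C₁)) →
     Entails ℓ (Context.T C₁) (proj₁ φ ⇔ᶠ proj₁ (τ₂ (τ₁ φ)))) ×
  ((ψ : Elem (Context.L C₂)) →
     Entails ℓ (Context.T C₂) (proj₁ ψ ⇔ᶠ proj₁ (τ₁ (τ₂ ψ))))

record Bridge (ℓ : Level) (𝔏₁ 𝔏₂ : Signature) : Set (lsuc ℓ) where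
  field
    C₁ : Context 𝔏₁
    C₂ : Context 𝔏₂
    σ     : (M : Structure 𝔏₂ ℓ) → M ⊨T Context.T C₂ → Structure 𝔏₁ ℓ
    σ-mod : (M : Structure 𝔏₂ ℓ) (p : M ⊨T Context.T C₂) → σ M p ⊨T Context.T C₁

module _ {ℓ 𝔏₁ 𝔏₂} (B : Bridge ℓ 𝔏₁ 𝔏₂) where
  open Bridge B
  open Context C₁ renaming (L to L₁; T to T₁)
  open Context C₂ renaming (L to L₂; T to T₂)

  IsInterpretation : (Elem L₁ → Elem L₂) → Set (lsuc ℓ)
  IsInterpretation ι =
    (M : Structure 𝔏₂ ℓ) (p : M ⊨T T₂) (φ : Elem L₁) →
      (σ M p ⊨ proj₁ φ) ⇔ (M ⊨ proj₁ (ι φ))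

  IsElimination : (Elem L₂ → Elem L₁) → Set (lsuc ℓ)
  IsElimination ε =
    (M : Structure 𝔏₂ ℓ) (p : M ⊨T T₂) (ψ : Elem L₂) →
      (σ M p ⊨ proj₁ (ε ψ)) ⇔ (M ⊨ proj₁ ψ)

  Sur : Set (lsuc ℓ)
  Sur =
    (N : Structure 𝔏₁ ℓ) → N ⊨T T₁ →
      Σ (Structure 𝔏₂ ℓ) λ M → Σ (M ⊨T T₂) λ p →
        (φ : Sentence 𝔏₁) → L₁ φ → (N ⊨ φ ⇔ σ M p ⊨ φ)

extendBridge : ∀ {ℓ 𝔏₁ 𝔏₂} (B : Bridge ℓ 𝔏₁ 𝔏₂) →
               (L̂₁ : Pred (Sentence 𝔏₁) 0ℓ) → IsFragment L̂₁ →
               (L̂₂ : Pred (Sentence 𝔏₂) 0ℓ) → IsFragment L̂₂ →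
               Bridge ℓ 𝔏₁ 𝔏₂
extendBridge B L̂₁ f₁ L̂₂ f₂ = record
  { C₁ = record { L = L̂₁ ; isFragment = f₁ ; T = Context.T (Bridge.C₁ B) }
  ; C₂ = record { L = L̂₂ ; isFragment = f₂ ; T = Context.T (Bridge.C₂ B) }
  ; σ = Bridge.σ B
  ; σ-mod = Bridge.σ-mod B }

restrictMap : ∀ {𝔏₁ 𝔏₂} {L₁ L̂₁ : Pred (Sentence 𝔏₁) 0ℓ} {L₂ L̂₂ : Pred (Sentence 𝔏₂) 0ℓ} →
              (inc : L₁ ⊆ L̂₁) → (ι : Elem L̂₁ → Elem L̂₂) →
              ((φ : Elem L₁) → L₂ (proj₁ (ι (proj₁ φ , inc (proj₂ φ))))) →
              Elem L₁ → Elem L₂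
restrictMap inc ι land φ = proj₁ (ι (proj₁ φ , inc (proj₂ φ))) , land φ

record Arch (ℓ : Level) (𝔏₁ 𝔏₂ : Signature) : Set (lsuc ℓ) where
  field
    B         : Bridge ℓ 𝔏₁ 𝔏₂
    L̂₁        : Pred (Sentence 𝔏₁) 0ℓ
    L̂₁-frag   : IsFragment L̂₁
    L̂₂        : Pred (Sentence 𝔏₂) 0ℓ
    L̂₂-frag   : IsFragment L̂₂
    L₁⊆L̂₁     : Context.L (Bridge.C₁ B) ⊆ L̂₁
    L₂⊆L̂₂     : Context.L (Bridge.C₂ B) ⊆ L̂₂
    ι         : Elem L̂₁ → Elem L̂₂
    ι-interp  : IsInterpretation (extendBridge B L̂₁ L̂₁-frag L̂₂ L̂₂-frag) ι
    ι-lands   : (φ : Elem (Context.L (Bridge.C₁ B))) →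
                Context.L (Bridge.C₂ B) (proj₁ (ι (proj₁ φ , L₁⊆L̂₁ (proj₂ φ))))
    ι|-interp : IsInterpretation B (restrictMap L₁⊆L̂₁ ι ι-lands)

  B̂ : Bridge ℓ 𝔏₁ 𝔏₂
  B̂ = extendBridge B L̂₁ L̂₁-frag L̂₂ L̂₂-frag

  L₁ : Pred (Sentence 𝔏₁) 0ℓ
  L₁ = Context.L (Bridge.C₁ B)

  L₂ : Pred (Sentence 𝔏₂) 0ℓ
  L₂ = Context.L (Bridge.C₂ B)

  T₁ : Theory 𝔏₁
  T₁ = Context.T (Bridge.C₁ B)

  T₂ : Theory 𝔏₂
  T₂ = Context.T (Bridge.C₂ B)

  ι|L₁ : Elem L₁ → Elem L₂
  ι|L₁ = restrictMap L₁⊆L̂₁ ι ι-lands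

  image : (R : Theory 𝔏₁) → R ⊆ L̂₁ → Theory 𝔏₂
  image R R⊆ ψ = Σ (Sentence 𝔏₁) λ φ → Σ (R φ) λ r → ψ ≡ proj₁ (ι (φ , R⊆ r))

module Submission where

open import Defs
open import Level using (Level)
open import Relation.Unary using (_⊆_; _∪_)
open import Data.Product using (_,_; proj₁; proj₂)
open import Data.Sum using (inj₁; inj₂)
open import Function.Bundles using (_⇔_; mk⇔; Equivalence)
open import Function.Properties.Equivalence using () renaming (sym to ⇔-sym; trans to ⇔-trans)
open import Relation.Binary.PropositionalEquality using (refl; subst; sym)

-- An interpretation and an elimination for a bridge always form a bitranslation once
-- the bridge satisfies (sur): (sur) lets every question about models of T₁ be asked of
-- some σ M instead, where ι and ε translate it faithfully.  Adding axioms R to T₁ and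
-- ιR to T₂ preserves all three hypotheses, because σ maps models of ιR to models of R
-- and (sur) for the extended fragment L̂₁ ⊇ R lifts models of R to models of ιR.

⊨⇔ᶠ : ∀ {𝔏 ℓ} (M : Structure 𝔏 ℓ) (φ ψ : Sentence 𝔏) → (M ⊨ φ) ⇔ (M ⊨ ψ) → M ⊨ (φ ⇔ᶠ ψ)
⊨⇔ᶠ M φ ψ φ⇔ψ = Equivalence.to φ⇔ψ , Equivalence.from φ⇔ψ

module BridgeProperties {ℓ 𝔏₁ 𝔏₂} (B : Bridge ℓ 𝔏₁ 𝔏₂) where
  open Bridge B
  open Context C₁ renaming (L to L₁; T to T₁)
  open Context C₂ renaming (L to L₂; T to T₂)
  open Equivalence

  ValidUnderσ : Sentence 𝔏₁ → Set (Level.suc ℓ)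
  ValidUnderσ φ = (M : Structure 𝔏₂ ℓ) (p : M ⊨T T₂) → σ M p ⊨ φ

  entails⇒validUnderσ : ∀ φ → Entails ℓ T₁ φ → ValidUnderσ φ
  entails⇒validUnderσ φ T₁⊨φ M p = T₁⊨φ (σ M p) (σ-mod M p)

  validUnderσ⇒entails : Sur B → (φ : Elem L₁) → ValidUnderσ (proj₁ φ) → Entails ℓ T₁ (proj₁ φ)
  validUnderσ⇒entails sur (φ , φ∈L₁) valid N N⊨T₁ =
    let (M , p , agree) = sur N N⊨T₁ in from (agree φ φ∈L₁) (valid M p)

  entails⇔validUnderσ : Sur B → (φ : Elem L₁) → Entails ℓ T₁ (proj₁ φ) ⇔ ValidUnderσ (proj₁ φ)
  entails⇔validUnderσ sur φ =
    mk⇔ (entails⇒validUnderσ (proj₁ φ)) (validUnderσ⇒entails sur φ)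

  -- φ ⇔ᶠ χ need not lie in the fragment L₁, so (sur) is applied to φ and χ separately.
  entails-⇔ᶠ : Sur B → (φ χ : Elem L₁) →
               ((M : Structure 𝔏₂ ℓ) (p : M ⊨T T₂) → (σ M p ⊨ proj₁ φ) ⇔ (σ M p ⊨ proj₁ χ)) →
               Entails ℓ T₁ (proj₁ φ ⇔ᶠ proj₁ χ)
  entails-⇔ᶠ sur (φ , φ∈L₁) (χ , χ∈L₁) σφ⇔σχ N N⊨T₁ =
    let (M , p , agree) = sur N N⊨T₁ in
    ⊨⇔ᶠ N φ χ (⇔-trans (agree φ φ∈L₁) (⇔-trans (σφ⇔σχ M p) (⇔-sym (agree χ χ∈L₁))))

  module _ (ι : Elem L₁ → Elem L₂) (ε : Elem L₂ → Elem L₁)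
           (ι-interp : IsInterpretation B ι) (ε-elim : IsElimination B ε) (sur : Sur B) where

    interpretation⇒translation : IsTranslation ℓ C₁ C₂ ι
    interpretation⇒translation φ = ⇔-trans (entails⇔validUnderσ sur φ) (mk⇔
      (λ valid M p → to (ι-interp M p φ) (valid M p))
      (λ T₂⊨ιφ M p → from (ι-interp M p φ) (T₂⊨ιφ M p)))

    elimination⇒translation : IsTranslation ℓ C₂ C₁ ε
    elimination⇒translation ψ = ⇔-sym (⇔-trans (entails⇔validUnderσ sur (ε ψ)) (mk⇔
      (λ valid M p → to (ε-elim M p ψ) (valid M p))
      (λ T₂⊨ψ M p → from (ε-elim M p ψ) (T₂⊨ψ M p))))

    bitranslation : IsBitranslation ℓ C₁ C₂ ι ε
    bitranslation =
        interpretation⇒translation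
      , elimination⇒translation
      , (λ φ → entails-⇔ᶠ sur φ (ε (ι φ)) λ M p →
           ⇔-trans (ι-interp M p φ) (⇔-sym (ε-elim M p (ι φ))))
      , (λ ψ M p → ⊨⇔ᶠ M (proj₁ ψ) (proj₁ (ι (ε ψ)))
           (⇔-trans (⇔-sym (ε-elim M p ψ)) (ι-interp M p (ε ψ))))

module _ {ℓ 𝔏₁ 𝔏₂} (A : Arch ℓ 𝔏₁ 𝔏₂) (R : Theory 𝔏₁) (R⊆L̂₁ : R ⊆ Arch.L̂₁ A) where
  open Arch A
  open Bridge B
  open Equivalence

  private
    T₂∪ιR⇒T₂ : ∀ {M : Structure 𝔏₂ ℓ} → M ⊨T (T₂ ∪ image R R⊆L̂₁) → M ⊨T T₂
    T₂∪ιR⇒T₂ M⊨T₂∪ιR ψ ψ∈T₂ = M⊨T₂∪ιR ψ (inj₁ ψ∈T₂)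

  withAxioms : Bridge ℓ 𝔏₁ 𝔏₂
  withAxioms = record
    { C₁    = withTheory C₁ (T₁ ∪ R)
    ; C₂    = withTheory C₂ (T₂ ∪ image R R⊆L̂₁)
    ; σ     = λ M q → σ M (T₂∪ιR⇒T₂ q)
    ; σ-mod = σ-mod′ }
    where
    σ-mod′ : (M : Structure 𝔏₂ ℓ) (q : M ⊨T (T₂ ∪ image R R⊆L̂₁)) →
             σ M (T₂∪ιR⇒T₂ q) ⊨T (T₁ ∪ R)
    σ-mod′ M q φ (inj₁ φ∈T₁) = σ-mod M (T₂∪ιR⇒T₂ q) φ φ∈T₁
    σ-mod′ M q φ (inj₂ φ∈R)  =
      from (ι-interp M (T₂∪ιR⇒T₂ q) (φ , R⊆L̂₁ φ∈R)) (q _ (inj₂ (φ , φ∈R , refl)))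

  withAxioms-interpretation : IsInterpretation withAxioms ι|L₁
  withAxioms-interpretation M q = ι|-interp M (T₂∪ιR⇒T₂ q)

  withAxioms-elimination : ∀ ε → IsElimination B ε → IsElimination withAxioms ε
  withAxioms-elimination ε ε-elim M q = ε-elim M (T₂∪ιR⇒T₂ q)

  withAxioms-sur : Sur B̂ → Sur withAxioms
  withAxioms-sur sur N N⊨T₁∪R =
    let (M , p , agree) = sur N (λ φ φ∈T₁ → N⊨T₁∪R φ (inj₁ φ∈T₁)) in
    M , M⊨T₂∪ιR M p agree , λ φ φ∈L₁ → agree φ (L₁⊆L̂₁ φ∈L₁)
    where
    M⊨T₂∪ιR : (M : Structure 𝔏₂ ℓ) (p : M ⊨T T₂) →
              ((φ : Sentence 𝔏₁) → L̂₁ φ → N ⊨ φ ⇔ σ M p ⊨ φ) →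
              M ⊨T (T₂ ∪ image R R⊆L̂₁)
    M⊨T₂∪ιR M p agree ψ (inj₁ ψ∈T₂)           = p ψ ψ∈T₂
    M⊨T₂∪ιR M p agree ψ (inj₂ (φ , φ∈R , ψ≡ιφ)) =
      subst (M ⊨_) (sym ψ≡ιφ)
        (to (ι-interp M p (φ , R⊆L̂₁ φ∈R)) (to (agree φ (R⊆L̂₁ φ∈R)) (N⊨T₁∪R φ (inj₂ φ∈R))))

proposition2p22 : ∀ {ℓ} {𝔏₁ 𝔏₂ : Signature} (A : Arch ℓ 𝔏₁ 𝔏₂)
    (ε : Elem (Arch.L₂ A) → Elem (Arch.L₁ A)) →
    IsElimination (Arch.B A) ε →
    Sur (Arch.B̂ A) →
    (R : Theory 𝔏₁) (R⊆L̂₁ : R ⊆ Arch.L̂₁ A) →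
    IsBitranslation ℓ
    (withTheory (Bridge.C₁ (Arch.B A)) (Arch.T₁ A ∪ R))
    (withTheory (Bridge.C₂ (Arch.B A)) (Arch.T₂ A ∪ Arch.image A R R⊆L̂₁))
    (Arch.ι|L₁ A) ε
proposition2p22 A ε ε-elim sur R R⊆L̂₁ =
  BridgeProperties.bitranslation (withAxioms A R R⊆L̂₁) (Arch.ι|L₁ A) ε
    (withAxioms-interpretation A R R⊆L̂₁)
    (withAxioms-elimination A R R⊆L̂₁ ε ε-elim)
    (withAxioms-sur A R R⊆L̂₁ sur)
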